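{- Let $n\ge 2$ targets $\mathcal T=\{1,\dots,n\}$ be given with travel times $c(u,v)>0$ ($u\ne v$) satisfying the triangle inequality. For every positive integer $p$, $\mathcal R^*(pn)=TSP^*$.
   Context: Targets $\mathcal T=\{1,\dots,n\}$, $n\ge 2$; travel times $c(u,v)>0$ for distinct $u,v\in\mathcal T$ (set $c(u,u)=0$), satisfying $c(u,v)+c(v,w)\ge c(u,w)$ for all $u,v,w\in\mathcal T$. $TSP^*$ denotes the minimum, over all orderings $(u_1,\dots,u_n)$ of $\mathcal T$, of $\sum_{i=1}^{n-1}c(u_i,u_{i+1})+c(u_n,u_1)$. For an integer $k\ge n$, a closed walk with $k$ visits is a sequence $\mathcal W=(v_1,\dots,v_{k+1})$ of targets with $v_{k+1}=v_1$, $v_i\ne v_{i+1}$ for $1\le i\le k$, and every target appearing among $v_1,\dots,v_k$. The walk is repeated forever: extend it to the infinite periodic sequence $(v_i)_{i\ge 1}$ with $v_{i+k}=v_i$, where moving from $v_i$ to $v_{i+1}$ takes time $c(v_i,v_{i+1})$. For a target $d$, the revisit time $RT(d,\mathcal W)$ is the maximum, over all pairs of indices $i<j$ with $v_i=v_j=d$ and $v_l\ne d$ for $i<l<j$, of $\sum_{l=i}^{j-1}c(v_l,v_{l+1})$. The revisit time of the walk is $\mathcal R(\mathcal W)=\max_{d\in\mathcal T}RT(d,\mathcal W)$, and $\mathcal R^*(k)$ is the minimum of $\mathcal R(\mathcal W)$ over all closed walks with $k$ visits.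
   Formalization: The travel times $c(u,v)$ are rational. -}

module Defs where

open import Data.Nat using (ℕ; zero; suc; _∸_) renaming (_+_ to _+ℕ_; _<_ to _<ℕ_)
open import Data.Fin using (Fin)
open import Data.List using (List; []; _∷_; _++_; [_]; allFin)
open import Data.List.Relation.Binary.Permutation.Propositional using (_↭_)
open import Data.Rational using (ℚ; 0ℚ; _+_; _≤_)
open import Data.Product using (Σ; ∃; _×_; _,_)
open import Relation.Binary.PropositionalEquality using (_≡_; _≢_)

-- Travel-time function on targets Fin n (targets 1..n are 0..n-1 here).
Cost : ℕ → Set
Cost n = Fin n → Fin n → ℚ

sumℚ : ℕ → (ℕ → ℚ) → ℚ
sumℚ zero    f = 0ℚ
sumℚ (suc m) f = sumℚ m f + f m

pathCost : ∀ {n} → Cost n → List (Fin n) → ℚ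
pathCost c (x ∷ y ∷ r) = c x y + pathCost c (y ∷ r)
pathCost c _           = 0ℚ

tourCost : ∀ {n} → Cost n → List (Fin n) → ℚ
tourCost c []      = 0ℚ
tourCost c (x ∷ r) = pathCost c ((x ∷ r) ++ [ x ])

Ordering : ℕ → Set
Ordering n = Σ (List (Fin n)) (λ us → us ↭ allFin n)

IsTSPOpt : ∀ {n} → Cost n → ℚ → Set
IsTSPOpt {n} c x =
  (Σ (Ordering n) λ o → tourCost c (Data.Product.proj₁ o) ≡ x) ×
  ((o : Ordering n) → x ≤ tourCost c (Data.Product.proj₁ o))

-- Closed walks with k visits, represented by their infinite periodic
-- extension (0-indexed): seq i = v_{i+1}.

record Walk (n k : ℕ) : Set where
  field
    seq      : ℕ → Fin n
    periodic : ∀ i → seq (i +ℕ k) ≡ seq i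
    noStay   : ∀ i → seq i ≢ seq (suc i)
    covers   : ∀ (d : Fin n) → ∃ λ i → i <ℕ k × seq i ≡ d
open Walk public

segCost : ∀ {n k} → Cost n → Walk n k → ℕ → ℕ → ℚ
segCost c W i j = sumℚ (j ∸ i) (λ t → c (seq W (i +ℕ t)) (seq W (suc (i +ℕ t))))

ConsecVisits : ∀ {n k} → Walk n k → Fin n → ℕ → ℕ → Set
ConsecVisits W d i j =
  i <ℕ j × seq W i ≡ d × seq W j ≡ d ×
  (∀ l → i <ℕ l → l <ℕ j → seq W l ≢ d)

IsRT : ∀ {n k} → Cost n → Walk n k → Fin n → ℚ → Set
IsRT c W d x =
  (∃ λ i → ∃ λ j → ConsecVisits W d i j × segCost c W i j ≡ x) ×
  (∀ i j → ConsecVisits W d i j → segCost c W i j ≤ x)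

IsR : ∀ {n k} → Cost n → Walk n k → ℚ → Set
IsR {n} c W x =
  (∀ (d : Fin n) → ∃ λ y → IsRT c W d y × y ≤ x) ×
  (∃ λ (d : Fin n) → IsRT c W d x)

IsRStar : ∀ {n} → Cost n → ℕ → ℚ → Set
IsRStar {n} c k x =
  (∃ λ (W : Walk n k) → IsR c W x) ×
  (∀ (W : Walk n k) y → IsR c W y → x ≤ y)

module Submission where

-- A tour repeated p times is a closed walk with pn visits in which any two consecutive
-- visits of a target are exactly n steps apart, so every revisit time equals the tour
-- cost. Conversely, in a walk of period k let z be the target whose first visit at or
-- after time k comes last, say at time b, and let a < k be the previous visit of z.
-- Every target is visited between a and b, so this stretch of the walk is a closed walk
-- through all targets; deleting repeated targets (shortcutting by the triangle
-- inequality) turns it into a tour costing at most RT(z) ≤ R(W).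

open import Defs
open import Data.Nat using (ℕ; zero; suc; _∸_; _*_; NonZero; >-nonZero; >-nonZero⁻¹; z≤n; s≤s; s≤s⁻¹; pred)
  renaming (_+_ to _+ℕ_; _<_ to _<ℕ_; _≤_ to _≤ℕ_)
open import Data.Nat.Properties
  using (+-suc; +-comm; +-identityʳ; ≤-refl; ≤-trans; <⇒≤; <⇒≱; ≰⇒>; <-≤-trans; n<1+n; m<n⇒m<1+n;
         m≤n⇒m<n∨m≡n; m<1+n⇒m<n∨m≡n; ≤∧≢⇒<; m<m+n; m<n⇒0<n∸m; m+[n∸m]≡n; m+n∸m≡n; suc-pred;
         [m+n]∸[m+o]≡n∸o;
         *-distribʳ-∸; *-identityˡ; *-monoˡ-≤; +-monoʳ-≤; +-monoʳ-<; ∸-monoˡ-<)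
open import Data.Nat.DivMod using (_%_; _/_; _mod_; m≡m%n+[m/n]*n; [m+n]%n≡m%n; [m+kn]%n≡m%n; m<n⇒m%n≡m)
open import Data.Nat.Divisibility using (_∣_; divides; ∣⇒≤)
open import Data.Rational using (ℚ; 0ℚ; _+_; _≤_; _<_)
import Data.Rational.Properties as ℚ
open import Relation.Binary.Bundles using (DecTotalOrder)
open import Algebra.Properties.Group ℚ.+-0-group using (∙-cancelˡ)
open import Data.Fin as Fin using (Fin; toℕ; _≟_)
open import Data.Fin.Properties using (toℕ<n; toℕ-fromℕ<; fromℕ<-cong; fromℕ<-toℕ; all?)
open import Data.List using (List; []; _∷_; _++_; [_]; length; lookup; filter; deduplicate; allFin; cartesianProductWith)
open import Data.List.Properties using (∷-injectiveˡ; length-tabulate)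
open import Data.List.Extrema (DecTotalOrder.totalOrder ℚ.≤-decTotalOrder) using (argmin; argmin-all; f[argmin]≤f[xs])
open import Data.List.Extrema.Nat using (argmax; f[xs]≤f[argmax])
open import Data.List.Membership.Propositional using (_∈_)
open import Data.List.Membership.Propositional.Properties
  using (∈-allFin; ∈-lookup; ∈-filter⁺; ∈-deduplicate⁺; ∈-cartesianProductWith⁺)
open import Data.List.Membership.DecPropositional using (_∈?_)
open import Data.List.Membership.Propositional.Properties.WithK using (unique∧set⇒bag)
open import Data.List.Relation.Unary.All as All using (All; []; _∷_)
open import Data.List.Relation.Unary.All.Properties using (all-filter)
open import Data.List.Relation.Unary.Any using (here; there; index)
open import Data.List.Relation.Unary.Any.Properties using (lookup-index)
open import Data.List.Relation.Unary.Unique.Propositional using (Unique)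
open import Data.List.Relation.Unary.AllPairs using (_∷_)
open import Data.List.Relation.Unary.Unique.Propositional.Properties using (allFin⁺)
open import Data.List.Relation.Unary.Unique.DecPropositional using (unique?)
open import Data.List.Relation.Unary.Unique.DecPropositional.Properties using (deduplicate-!)
open import Data.List.Relation.Binary.Sublist.Propositional using (_⊆_; []; _∷_; _∷ʳ_; ⊆-trans)
open import Data.List.Relation.Binary.Sublist.Propositional.Properties using (filter-⊆)
open import Data.List.Relation.Binary.Permutation.Propositional using (_↭_; ↭-refl; ↭-sym; ↭⇒↭ₛ)
open import Data.List.Relation.Binary.Permutation.Propositional.Properties using (∈-resp-↭; ↭-length)
open import Data.List.Relation.Binary.BagAndSetEquality using (∼bag⇒↭)
open import Data.Product using (∃; ∃₂; _×_; _,_; proj₁; proj₂)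
open import Data.Sum using (inj₁; inj₂; [_,_]′)
open import Function using (_∘_; _⇔_; mk⇔; Equivalence)
open import Function.Properties.Equivalence using () renaming (sym to ⇔-sym)
open import Relation.Binary.PropositionalEquality hiding ([_])
open import Relation.Nullary using (¬_; Dec; yes; no; contradiction)
open import Relation.Nullary.Decidable as Dec using (_×-dec_)
open import Relation.Unary using (Decidable)
open import Relation.Binary.Definitions using (DecidableEquality)

TriangleInequality : ∀ {n} → Cost n → Set
TriangleInequality c = ∀ u v w → c u w ≤ c u v + c v w

sumℚ-cong : ∀ m {f g : ℕ → ℚ} → (∀ t → f t ≡ g t) → sumℚ m f ≡ sumℚ m g
sumℚ-cong zero    f≗g = refl
sumℚ-cong (suc m) f≗g = cong₂ _+_ (sumℚ-cong m f≗g) (f≗g m)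

sumℚ-suc : ∀ m (f : ℕ → ℚ) → sumℚ (suc m) f ≡ f 0 + sumℚ m (f ∘ suc)
sumℚ-suc zero    f = trans (ℚ.+-identityˡ (f 0)) (sym (ℚ.+-identityʳ (f 0)))
sumℚ-suc (suc m) f = begin
  sumℚ (suc m) f + f (suc m)            ≡⟨ cong (_+ f (suc m)) (sumℚ-suc m f) ⟩
  (f 0 + sumℚ m (f ∘ suc)) + f (suc m)  ≡⟨ ℚ.+-assoc (f 0) _ _ ⟩
  f 0 + sumℚ (suc m) (f ∘ suc)          ∎
  where open ≡-Reasoning

sumℚ-shift : ∀ m (h : ℕ → ℚ) → h m ≡ h 0 → sumℚ m (h ∘ suc) ≡ sumℚ m h
sumℚ-shift m h hm≡h0 = ∙-cancelˡ (h 0) _ _ (begin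
  h 0 + sumℚ m (h ∘ suc)  ≡⟨ sumℚ-suc m h ⟨
  sumℚ m h + h m          ≡⟨ cong (sumℚ m h +_) hm≡h0 ⟩
  sumℚ m h + h 0          ≡⟨ ℚ.+-comm (sumℚ m h) (h 0) ⟩
  h 0 + sumℚ m h          ∎)
  where open ≡-Reasoning

sumℚ-rotate : ∀ m (h : ℕ → ℚ) → (∀ t → h (t +ℕ m) ≡ h t) →
              ∀ i → sumℚ m (λ t → h (i +ℕ t)) ≡ sumℚ m h
sumℚ-rotate m h periodic zero    = refl
sumℚ-rotate m h periodic (suc i) = begin
  sumℚ m (λ t → h (suc i +ℕ t))  ≡⟨ sumℚ-cong m (λ t → cong h (+-suc i t)) ⟨
  sumℚ m (λ t → h (i +ℕ suc t))  ≡⟨ sumℚ-shift m (λ t → h (i +ℕ t)) hi+m≡hi+0 ⟩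
  sumℚ m (λ t → h (i +ℕ t))      ≡⟨ sumℚ-rotate m h periodic i ⟩
  sumℚ m h                       ∎
  where
  open ≡-Reasoning
  hi+m≡hi+0 : h (i +ℕ m) ≡ h (i +ℕ 0)
  hi+m≡hi+0 = trans (periodic i) (cong h (sym (+-identityʳ i)))

visits : ∀ {A : Set} → (ℕ → A) → ℕ → List A
visits s zero    = []
visits s (suc j) = s 0 ∷ visits (s ∘ suc) j

∈-visits : ∀ {A : Set} (s : ℕ → A) {j t} → t <ℕ j → s t ∈ visits s j
∈-visits s {suc j} {zero}  _         = here refl
∈-visits s {suc j} {suc t} (s≤s t<j) = there (∈-visits (s ∘ suc) t<j)

visits-lookup : ∀ {A : Set} (s : ℕ → A) xs → (∀ i → s (toℕ i) ≡ lookup xs i) → visits s (length xs) ≡ xs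
visits-lookup s []       _    = refl
visits-lookup s (x ∷ xs) s≗xs = cong₂ _∷_ (s≗xs Fin.zero) (visits-lookup (s ∘ suc) xs (s≗xs ∘ Fin.suc))

module _ {n : ℕ} (c : Cost n) where

  pathCost-visits : ∀ (s : ℕ → Fin n) j →
                    pathCost c (visits s j ++ [ s j ]) ≡ sumℚ j (λ t → c (s t) (s (suc t)))
  pathCost-visits s zero    = refl
  pathCost-visits s (suc j) = begin
    pathCost c (s 0 ∷ visits (s ∘ suc) j ++ [ s (suc j) ])          ≡⟨ unfold j ⟩
    c (s 0) (s 1) + pathCost c (visits (s ∘ suc) j ++ [ s (suc j) ])  ≡⟨ cong (c (s 0) (s 1) +_) (pathCost-visits (s ∘ suc) j) ⟩
    c (s 0) (s 1) + sumℚ j (λ t → c (s (suc t)) (s (suc (suc t))))   ≡⟨ sumℚ-suc j _ ⟨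
    sumℚ (suc j) (λ t → c (s t) (s (suc t)))                          ∎
    where
    open ≡-Reasoning
    unfold : ∀ j → pathCost c (s 0 ∷ visits (s ∘ suc) j ++ [ s (suc j) ])
                   ≡ c (s 0) (s 1) + pathCost c (visits (s ∘ suc) j ++ [ s (suc j) ])
    unfold zero    = refl
    unfold (suc j) = refl

  tourCost≡sum : ∀ (s : ℕ → Fin n) {xs} → visits s (length xs) ≡ xs → s (length xs) ≡ s 0 →
                 tourCost c xs ≡ sumℚ (length xs) (λ t → c (s t) (s (suc t)))
  tourCost≡sum s {[]}    _         _      = refl
  tourCost≡sum s {x ∷ r} visits≡xs closes = begin
    pathCost c ((x ∷ r) ++ [ x ])     ≡⟨ cong₂ (λ ys y → pathCost c (ys ++ [ y ])) (sym visits≡xs) x≡sL ⟩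
    pathCost c (visits s L ++ [ s L ]) ≡⟨ pathCost-visits s L ⟩
    sumℚ L (λ t → c (s t) (s (suc t))) ∎
    where
    open ≡-Reasoning
    L : ℕ
    L = length (x ∷ r)
    x≡sL : x ≡ s L
    x≡sL = sym (trans closes (∷-injectiveˡ visits≡xs))

deduplicate-⊆ : ∀ {A : Set} (_≟_ : DecidableEquality A) xs → deduplicate _≟_ xs ⊆ xs
deduplicate-⊆ _≟_ []       = []
deduplicate-⊆ _≟_ (x ∷ xs) = refl ∷ ⊆-trans (filter-⊆ _ _) (deduplicate-⊆ _≟_ xs)

module _ {n : ℕ} where

  ↭-allFin⇔ : ∀ {xs : List (Fin n)} → (xs ↭ allFin n) ⇔ (Unique xs × (∀ d → d ∈ xs))
  ↭-allFin⇔ = mk⇔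
    (λ xs↭ → Unique-resp-↭ (↭⇒↭ₛ (↭-sym xs↭)) (allFin⁺ n) , λ d → ∈-resp-↭ (↭-sym xs↭) (∈-allFin d))
    (λ (uniq , complete) →
      ∼bag⇒↭ (unique∧set⇒bag uniq (allFin⁺ n) (mk⇔ (λ _ → ∈-allFin _) (λ _ → complete _))))
    where open import Data.List.Relation.Binary.Permutation.Setoid.Properties (setoid (Fin n)) using (Unique-resp-↭)

  ordering? : ∀ (xs : List (Fin n)) → Dec (xs ↭ allFin n)
  ordering? xs = Dec.map (⇔-sym ↭-allFin⇔) (unique? _≟_ xs ×-dec all? (λ d → _∈?_ _≟_ d xs))

  ordering-length : ∀ {xs : List (Fin n)} → xs ↭ allFin n → length xs ≡ n
  ordering-length xs↭ = trans (↭-length xs↭) (length-tabulate {n = n} (λ i → i))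

lists : ∀ {A : Set} → List A → ℕ → List (List A)
lists xs zero    = [ [] ]
lists xs (suc m) = cartesianProductWith _∷_ xs (lists xs m)

∈-lists : ∀ {A : Set} {xs ys : List A} → All (_∈ xs) ys → ys ∈ lists xs (length ys)
∈-lists []           = here refl
∈-lists (y∈xs ∷ ys⊆) = ∈-cartesianProductWith⁺ _∷_ y∈xs (∈-lists ys⊆)

tsp-optimum : ∀ {n} (c : Cost n) → ∃ (IsTSPOpt c)
tsp-optimum {n} c = tourCost c best , ((best , best-ordering) , refl) , best-minimal
  where
  candidates : List (List (Fin n))
  candidates = filter ordering? (lists (allFin n) n)
  best : List (Fin n)
  best = argmin (tourCost c) (allFin n) candidates
  best-ordering : best ↭ allFin n
  best-ordering = argmin-all (tourCost c) ↭-refl (all-filter ordering? (lists (allFin n) n))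
  best-minimal : (o : Ordering n) → tourCost c best ≤ tourCost c (proj₁ o)
  best-minimal (us , us↭) = All.lookup (f[argmin]≤f[xs] (allFin n) candidates) (∈-filter⁺ ordering? us∈lists us↭)
    where
    us∈lists : us ∈ lists (allFin n) n
    us∈lists = subst (λ m → us ∈ lists (allFin n) m) (ordering-length us↭) (∈-lists (All.tabulate (λ _ → ∈-allFin _)))

module _ {n : ℕ} {c : Cost n} (tri : TriangleInequality c) where

  pathCost-via : ∀ x y w ws → pathCost c (x ∷ w ∷ ws) ≤ c x y + pathCost c (y ∷ w ∷ ws)
  pathCost-via x y w ws = ℚ.≤-trans (ℚ.+-monoˡ-≤ _ (tri x y w)) (ℚ.≤-reflexive (ℚ.+-assoc (c x y) (c y w) _))

  pathCost-detour : ∀ x y e ws → pathCost c (x ∷ ws ++ [ e ]) ≤ c x y + pathCost c (y ∷ ws ++ [ e ])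
  pathCost-detour x y e []       = pathCost-via x y e []
  pathCost-detour x y e (w ∷ ws) = pathCost-via x y w (ws ++ [ e ])

  pathCost-shortcut : ∀ {ys zs} → ys ⊆ zs → ∀ x e → pathCost c (x ∷ ys ++ [ e ]) ≤ pathCost c (x ∷ zs ++ [ e ])
  pathCost-shortcut []             x e = ℚ.≤-refl
  pathCost-shortcut {ys} (y ∷ʳ ys⊆zs) x e =
    ℚ.≤-trans (pathCost-detour x y e ys) (ℚ.+-monoʳ-≤ (c x y) (pathCost-shortcut ys⊆zs y e))
  pathCost-shortcut (refl ∷ ys⊆zs) x e = ℚ.+-monoʳ-≤ (c x _) (pathCost-shortcut ys⊆zs _ e)

  tour-≤-closedWalk : ∀ (s : ℕ → Fin n) m → s (suc m) ≡ s 0 → (∀ d → ∃ λ t → t <ℕ suc m × s t ≡ d) →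
                      ∃ λ (o : Ordering n) → tourCost c (proj₁ o) ≤ sumℚ (suc m) (λ t → c (s t) (s (suc t)))
  tour-≤-closedWalk s m closes visited = (tour , tour↭) , (begin
    tourCost c tour                                    ≤⟨ pathCost-shortcut (⊆-trans (filter-⊆ _ _) (deduplicate-⊆ _≟_ ys)) (s 0) (s 0) ⟩
    pathCost c (s 0 ∷ ys ++ [ s 0 ])                   ≡⟨ cong (λ e → pathCost c (s 0 ∷ ys ++ [ e ])) closes ⟨
    pathCost c (visits s (suc m) ++ [ s (suc m) ])     ≡⟨ pathCost-visits c s (suc m) ⟩
    sumℚ (suc m) (λ t → c (s t) (s (suc t)))           ∎)
    where
    open ℚ.≤-Reasoning
    ys : List (Fin n)
    ys = visits (s ∘ suc) m
    tour : List (Fin n)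
    tour = deduplicate _≟_ (s 0 ∷ ys)
    tour↭ : tour ↭ allFin n
    tour↭ = Equivalence.from ↭-allFin⇔ (deduplicate-! _≟_ (s 0 ∷ ys) , λ d →
      let t , t<1+m , st≡d = visited d in ∈-deduplicate⁺ _≟_ (subst (_∈ s 0 ∷ ys) st≡d (∈-visits s t<1+m)))

m%n≡o%n⇒m+n≤o : ∀ {m n o} .{{_ : NonZero n}} → m % n ≡ o % n → m <ℕ o → m +ℕ n ≤ℕ o
m%n≡o%n⇒m+n≤o {m} {n} {o} m%n≡o%n m<o = begin
  m +ℕ n        ≤⟨ +-monoʳ-≤ m (∣⇒≤ {{>-nonZero (m<n⇒0<n∸m m<o)}} n∣o∸m) ⟩
  m +ℕ (o ∸ m)  ≡⟨ m+[n∸m]≡n (<⇒≤ m<o) ⟩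
  o             ∎
  where
  open Data.Nat.Properties.≤-Reasoning
  n∣o∸m : n ∣ o ∸ m
  n∣o∸m = divides (o / n ∸ m / n) (begin-equality
    o ∸ m                                        ≡⟨ cong₂ _∸_ (m≡m%n+[m/n]*n o n) (m≡m%n+[m/n]*n m n) ⟩
    (o % n +ℕ o / n * n) ∸ (m % n +ℕ m / n * n)  ≡⟨ cong (λ r → (o % n +ℕ o / n * n) ∸ (r +ℕ m / n * n)) m%n≡o%n ⟩
    (o % n +ℕ o / n * n) ∸ (o % n +ℕ m / n * n)  ≡⟨ [m+n]∸[m+o]≡n∸o (o % n) _ _ ⟩
    o / n * n ∸ m / n * n                        ≡⟨ *-distribʳ-∸ n (o / n) (m / n) ⟨
    (o / n ∸ m / n) * n                          ∎)

lookup-injective : ∀ {A : Set} {xs : List A} → Unique xs → ∀ {i j} → lookup xs i ≡ lookup xs j → i ≡ j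
lookup-injective (_ ∷ _)         {Fin.zero}  {Fin.zero}  _  = refl
lookup-injective (x∉xs ∷ _)     {Fin.zero}  {Fin.suc j} eq = contradiction eq (All.lookup x∉xs (∈-lookup j))
lookup-injective (x∉xs ∷ _)     {Fin.suc i} {Fin.zero}  eq = contradiction (sym eq) (All.lookup x∉xs (∈-lookup i))
lookup-injective (_ ∷ xs-unique) {Fin.suc i} {Fin.suc j} eq = cong Fin.suc (lookup-injective xs-unique eq)

module CyclicWalk {n : ℕ} (c : Cost n) {us : List (Fin n)} (us↭ : us ↭ allFin n) (2≤n : 2 ≤ℕ n) where

  private
    L : ℕ
    L = length us

    L≡n : L ≡ n
    L≡n = ordering-length us↭

    2≤L : 2 ≤ℕ L
    2≤L = subst (2 ≤ℕ_) (sym L≡n) 2≤n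

    instance
      L-nonZero : NonZero L
      L-nonZero = >-nonZero (<-≤-trans (s≤s z≤n) 2≤L)

    us-unique : Unique us
    us-unique = proj₁ (Equivalence.to ↭-allFin⇔ us↭)

    us-complete : ∀ d → d ∈ us
    us-complete = proj₂ (Equivalence.to ↭-allFin⇔ us↭)

  cycle : ℕ → Fin n
  cycle i = lookup us (i mod L)

  cycle-lookup : ∀ i → cycle (toℕ i) ≡ lookup us i
  cycle-lookup i = cong (lookup us) (trans (fromℕ<-cong _ _ (m<n⇒m%n≡m (toℕ<n i)) _ _) (fromℕ<-toℕ i (toℕ<n i)))

  cycle-+L : ∀ i → cycle (i +ℕ L) ≡ cycle i
  cycle-+L i = cong (lookup us) (fromℕ<-cong _ _ ([m+n]%n≡m%n i L) _ _)

  cycle-+kL : ∀ k i → cycle (i +ℕ k * L) ≡ cycle i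
  cycle-+kL k i = cong (lookup us) (fromℕ<-cong _ _ ([m+kn]%n≡m%n i k L) _ _)

  cycle-revisit : ∀ {i j} → i <ℕ j → cycle i ≡ cycle j → i +ℕ L ≤ℕ j
  cycle-revisit {i} {j} i<j ci≡cj = m%n≡o%n⇒m+n≤o i%L≡j%L i<j
    where
    i%L≡j%L : i % L ≡ j % L
    i%L≡j%L = trans (sym (toℕ-fromℕ< _)) (trans (cong toℕ (lookup-injective us-unique ci≡cj)) (toℕ-fromℕ< _))

  cycle-visits : ∀ d → ∃ λ t → t <ℕ L × cycle t ≡ d
  cycle-visits d = toℕ t , toℕ<n t , trans (cycle-lookup t) (sym (lookup-index (us-complete d)))
    where
    t : Fin L
    t = index (us-complete d)

  cycle-sum : sumℚ L (λ t → c (cycle t) (cycle (suc t))) ≡ tourCost c us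
  cycle-sum = sym (tourCost≡sum c cycle (visits-lookup cycle us cycle-lookup) (cycle-+L 0))

  module _ (p : ℕ) (1≤p : 1 ≤ℕ p) where

    walk : Walk n (p * L)
    walk = record
      { seq      = cycle
      ; periodic = cycle-+kL p
      ; noStay   = λ i ci≡ci+1 → <⇒≱ (1+i<i+L i) (cycle-revisit (n<1+n i) ci≡ci+1)
      ; covers   = λ d → let t , t<L , ct≡d = cycle-visits d in t , <-≤-trans t<L L≤pL , ct≡d
      }
      where
      1+i<i+L : ∀ i → suc i <ℕ i +ℕ L
      1+i<i+L i = subst (_<ℕ i +ℕ L) (+-comm i 1) (+-monoʳ-< i 2≤L)
      L≤pL : L ≤ℕ p * L
      L≤pL = subst (_≤ℕ p * L) (*-identityˡ L) (*-monoˡ-≤ L 1≤p)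

    segCost-period : ∀ i → segCost c walk i (i +ℕ L) ≡ tourCost c us
    segCost-period i = begin
      sumℚ (i +ℕ L ∸ i) (λ t → h (i +ℕ t))  ≡⟨ cong (λ m → sumℚ m (λ t → h (i +ℕ t))) (m+n∸m≡n i L) ⟩
      sumℚ L (λ t → h (i +ℕ t))             ≡⟨ sumℚ-rotate L h (λ t → cong₂ c (cycle-+L t) (cycle-+L (suc t))) i ⟩
      sumℚ L h                              ≡⟨ cycle-sum ⟩
      tourCost c us                         ∎
      where
      open ≡-Reasoning
      h : ℕ → ℚ
      h t = c (cycle t) (cycle (suc t))

    consecutive⇒period : ∀ {d i j} → ConsecVisits walk d i j → j ≡ i +ℕ L
    consecutive⇒period {i = i} (i<j , ci≡d , cj≡d , unvisited)
      with m≤n⇒m<n∨m≡n (cycle-revisit i<j (trans ci≡d (sym cj≡d)))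
    ... | inj₂ i+L≡j = sym i+L≡j
    ... | inj₁ i+L<j = contradiction (trans (cycle-+L i) ci≡d) (unvisited (i +ℕ L) (m<m+n i (>-nonZero⁻¹ L)) i+L<j)

    period-consecutive : ∀ {d t} → cycle t ≡ d → ConsecVisits walk d t (t +ℕ L)
    period-consecutive {t = t} ct≡d = m<m+n t (>-nonZero⁻¹ L) , ct≡d , trans (cycle-+L t) ct≡d ,
      λ l t<l l<t+L cl≡d → <⇒≱ l<t+L (cycle-revisit t<l (trans ct≡d (sym cl≡d)))

    walk-RT : ∀ d → IsRT c walk d (tourCost c us)
    walk-RT d = let t , _ , ct≡d = cycle-visits d in
      (t , t +ℕ L , period-consecutive ct≡d , segCost-period t) ,
      λ i j i→j → ℚ.≤-reflexive (trans (cong (segCost c walk i) (consecutive⇒period i→j)) (segCost-period i))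

    walk-R : IsR c walk (tourCost c us)
    walk-R = (λ d → tourCost c us , walk-RT d , ℚ.≤-refl) , cycle 0 , walk-RT (cycle 0)

  cyclicWalk : ∀ p → 1 ≤ℕ p → ∃ λ (W : Walk n (p * n)) → IsR c W (tourCost c us)
  cyclicWalk p 1≤p = subst (λ m → ∃ λ (W : Walk n (p * m)) → IsR c W (tourCost c us)) L≡n (walk p 1≤p , walk-R p 1≤p)

module _ {P : ℕ → Set} (P? : Decidable P) where

  first-from : ∀ t d → P (t +ℕ d) → ∃ λ b → t ≤ℕ b × P b × (∀ l → t ≤ℕ l → l <ℕ b → ¬ P l)
  first-from t d p with P? t
  ... | yes pt = t , ≤-refl , pt , λ l t≤l l<t → contradiction t≤l (<⇒≱ l<t)
  first-from t zero    p | no ¬pt = contradiction (subst P (+-identityʳ t) p) ¬pt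
  first-from t (suc d) p | no ¬pt with first-from (suc t) d (subst P (+-suc t d) p)
  ... | b , t<b , pb , before = b , <⇒≤ t<b , pb ,
        λ l t≤l l<b → [ (λ t<l → before l t<l l<b) , (λ { refl → ¬pt }) ]′ (m≤n⇒m<n∨m≡n t≤l)

  last-before : ∀ b {i} → i <ℕ b → P i → ∃ λ a → a <ℕ b × P a × (∀ l → a <ℕ l → l <ℕ b → ¬ P l)
  last-before (suc b) i<1+b pi with P? b
  ... | yes pb = b , n<1+n b , pb , λ l b<l l<1+b → contradiction (s≤s⁻¹ l<1+b) (<⇒≱ b<l)
  ... | no ¬pb with m<1+n⇒m<n∨m≡n i<1+b
  ...   | inj₂ refl = contradiction pi ¬pb
  ...   | inj₁ i<b with last-before b i<b pi
  ...     | a , a<b , pa , after = a , m<n⇒m<1+n a<b , pa ,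
            λ l a<l l<1+b → [ after l a<l , (λ { refl → ¬pb }) ]′ (m<1+n⇒m<n∨m≡n l<1+b)

module _ {n k : ℕ} (W : Walk (suc n) k) where

  private
    s : ℕ → Fin (suc n)
    s = seq W

  -- Opaque so that with-abstraction cannot unfold the searches and the argmax: doing so
  -- makes the terms explode when the lemmas below are used.
  opaque
    first-visit-from-k : ∀ d → ∃ λ b → k ≤ℕ b × s b ≡ d × (∀ l → k ≤ℕ l → l <ℕ b → s l ≢ d)
    first-visit-from-k d with i , _ , si≡d ← covers W d =
      first-from (λ l → s l ≟ d) k i (trans (cong s (+-comm k i)) (trans (periodic W i) si≡d))

    arrival : Fin (suc n) → ℕ
    arrival d = proj₁ (first-visit-from-k d)

    arrival-spec : ∀ d → k ≤ℕ arrival d × s (arrival d) ≡ d × (∀ l → k ≤ℕ l → l <ℕ arrival d → s l ≢ d)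
    arrival-spec d = proj₂ (first-visit-from-k d)

    latest-arrival : ∃ λ z → ∀ d → arrival d ≤ℕ arrival z
    latest-arrival = argmax arrival Fin.zero (allFin (suc n)) ,
      λ d → All.lookup (f[xs]≤f[argmax] {f = arrival} Fin.zero (allFin (suc n))) (∈-allFin d)

  visited-since : ∀ {z a} → (∀ d → arrival d ≤ℕ arrival z) → a <ℕ k → a <ℕ arrival z → s a ≡ z →
                  ∀ d → ∃ λ l → a ≤ℕ l × l <ℕ arrival z × s l ≡ d
  visited-since {z} {a} arrival≤z a<k a<b sa≡z d with d ≟ z
  ... | yes refl = a , ≤-refl , a<b , sa≡z
  ... | no d≢z
    with k≤l , sl≡d , _ ← arrival-spec d
    with _ , sb≡z , _ ← arrival-spec z
    = arrival d , ≤-trans (<⇒≤ a<k) k≤l ,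
      ≤∧≢⇒< (arrival≤z d) (λ l≡b → d≢z (trans (sym sl≡d) (trans (cong s l≡b) sb≡z))) , sl≡d

  covering-consecutive-visits : ∃ λ z → ∃₂ λ a b →
                                ConsecVisits W z a b × (∀ d → ∃ λ l → a ≤ℕ l × l <ℕ b × s l ≡ d)
  covering-consecutive-visits
    with z , arrival≤z ← latest-arrival
    with i , i<k , si≡z ← covers W z
    with k≤b , sb≡z , unvisited-from-k ← arrival-spec z
    with a , a<b , sa≡z , unvisited ← last-before (λ l → s l ≟ z) (arrival z) (<-≤-trans i<k k≤b) si≡z
    = z , a , arrival z , (a<b , sa≡z , sb≡z , unvisited) ,
      visited-since arrival≤z (≰⇒> (λ k≤a → unvisited-from-k a k≤a a<b sa≡z)) a<b sa≡z

module _ {n : ℕ} {c : Cost n} (tri : TriangleInequality c) {k : ℕ} (W : Walk n k) where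

  tour-≤-segCost : ∀ {z a b} → ConsecVisits W z a b → (∀ d → ∃ λ l → a ≤ℕ l × l <ℕ b × seq W l ≡ d) →
                   ∃ λ (o : Ordering n) → tourCost c (proj₁ o) ≤ segCost c W a b
  tour-≤-segCost {a = a} {b} (a<b , sa≡z , sb≡z , _) visited =
    let o , o≤sum = tour-≤-closedWalk tri s m closes visited-from-a in
    o , (begin
      tourCost c (proj₁ o)                             ≤⟨ o≤sum ⟩
      sumℚ (suc m) (λ t → c (s t) (s (suc t)))         ≡⟨ cong (λ j → sumℚ j (λ t → c (s t) (s (suc t)))) 1+m≡b∸a ⟩
      sumℚ (b ∸ a) (λ t → c (s t) (s (suc t)))         ≡⟨ sumℚ-cong (b ∸ a) (λ t → cong (λ i → c (s t) (seq W i)) (+-suc a t)) ⟩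
      segCost c W a b                                  ∎)
    where
    open ℚ.≤-Reasoning
    s : ℕ → Fin n
    s t = seq W (a +ℕ t)
    instance
      b∸a-nonZero : NonZero (b ∸ a)
      b∸a-nonZero = >-nonZero (m<n⇒0<n∸m a<b)
    m : ℕ
    m = pred (b ∸ a)
    1+m≡b∸a : suc m ≡ b ∸ a
    1+m≡b∸a = suc-pred (b ∸ a)
    closes : s (suc m) ≡ s 0
    closes = trans (cong (seq W) a+1+m≡b) (trans sb≡z (trans (sym sa≡z) (cong (seq W) (sym (+-identityʳ a)))))
      where
      a+1+m≡b : a +ℕ suc m ≡ b
      a+1+m≡b = trans (cong (a +ℕ_) 1+m≡b∸a) (m+[n∸m]≡n (<⇒≤ a<b))
    visited-from-a : ∀ d → ∃ λ t → t <ℕ suc m × s t ≡ d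
    visited-from-a d =
      let l , a≤l , l<b , sl≡d = visited d in
      l ∸ a , subst (l ∸ a <ℕ_) (sym 1+m≡b∸a) (∸-monoˡ-< l<b a≤l) , trans (cong (seq W) (m+[n∸m]≡n a≤l)) sl≡d

tsp-≤-R : ∀ {n k x y} {c : Cost (suc n)} → TriangleInequality c → IsTSPOpt c x →
                    (W : Walk (suc n) k) → IsR c W y → x ≤ y
tsp-≤-R {x = x} {y} {c} tri (_ , minimal) W (bounded , _)
  with z , a , b , a→b , visited ← covering-consecutive-visits W
  with o , o≤seg ← tour-≤-segCost tri W a→b visited
  with rt , (_ , rt-max) , rt≤y ← bounded z
  = begin
    x                     ≤⟨ minimal o ⟩
    tourCost c (proj₁ o)  ≤⟨ o≤seg ⟩
    segCost c W a b       ≤⟨ rt-max a b a→b ⟩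
    rt                    ≤⟨ rt≤y ⟩
    y                     ∎
  where open ℚ.≤-Reasoning

lemma7 : (n : ℕ) → 2 ≤ℕ n → (c : Cost n) →
         (∀ u → c u u ≡ 0ℚ) →
         (∀ u v → u ≢ v → 0ℚ < c u v) →
         (∀ u v w → c u w ≤ c u v + c v w) →
         (p : ℕ) → 1 ≤ℕ p →
         ∃ λ x → IsTSPOpt c x × IsRStar c (p * n) x
lemma7 zero () _ _ _ _ _ _
lemma7 (suc n) 2≤n c _ _ tri p 1≤p
  with x , opt@(((us , us↭) , us-cost) , _) ← tsp-optimum c
  = x , opt , subst (λ r → ∃ λ W → IsR c W r) us-cost (CyclicWalk.cyclicWalk c us↭ 2≤n p 1≤p) ,
    λ W _ → tsp-≤-R tri opt W
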